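{- Let $L$ be a first-order language and suppose there exist formulas $\alpha(\vec v),\beta(\vec v)$ of $L$ and tuples $\vec t,\vec s$ of closed terms such that: (a) $\alpha(\vec s)$ and $\beta(\vec t)$ are the same formula; (b) $\alpha(\vec t)$ and $\beta(\vec s)$ are the same formula; (c) both $\alpha(\vec t)\wedge\neg\beta(\vec t)$ and $\neg\alpha(\vec t)\wedge\beta(\vec t)$ are satisfiable. Then for every choice function $f$ for $Fml(L)$ there exist an $L$-structure $\mathcal M$, a formula $\psi(\vec v)$ of $L_s$ and a tuple $\vec r$ of closed terms such that $\langle\mathcal M,f\rangle\models^1_s\forall\vec v\,\psi(\vec v)\wedge\neg\psi(\vec r)$.
   Context: $L$ is a first-order language with logical symbols $\wedge,\neg,\forall$ and equality; the other connectives and $\exists=\neg\forall\neg$ are abbreviations. $L_s=L\cup\{|\}$, where $|$ is a new binary connective; $Fml(L_s)$ is the set of all formulas built by the usual recursion together with the clause that $\varphi|\psi$ is a formula whenever $\varphi,\psi$ are. $Fml(L)$ is the set of formulas of $L$. A choice function for $Fml(L)$ is a map $f$ assigning to each unordered pair $\{\alpha,\beta\}$ of formulas of $L$ (singletons included) an element $f(\alpha,\beta)\in\{\alpha,\beta\}$; thus $f(\alpha,\beta)=f(\beta,\alpha)$ and $f(\alpha,\alpha)=\alpha$. Its collapsing map $\overline f:Fml(L_s)\to Fml(L)$ is defined recursively by $\overline f(\alpha)=\alpha$ for $\alpha\in Fml(L)$, $\overline f(\varphi\wedge\psi)=\overline f(\varphi)\wedge\overline f(\psi)$, $\overline f(\neg\varphi)=\neg\overline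 f(\varphi)$, $\overline f(\forall v\varphi)=\forall v\,\overline f(\varphi)$, $\overline f(\varphi|\psi)=f(\overline f(\varphi),\overline f(\psi))$. For an $L$-structure $\mathcal M$ and a sentence $\varphi$ of $L_s$, $\langle\mathcal M,f\rangle\models^1_s\varphi$ iff $\mathcal M\models\overline f(\varphi)$. $\alpha(\vec t)$ denotes simultaneous substitution of the terms $\vec t$ for the variables $\vec v$. -}

module Defs where

open import Data.Nat using (ℕ; _≟_)
open import Data.Fin using (Fin)
open import Data.Vec using (Vec; []; _∷_; lookup)
open import Data.Vec.Membership.Propositional using (_∈_)
open import Data.Product using (Σ; _×_; _,_)
open import Data.Sum using (_⊎_)
open import Data.Empty using (⊥)
open import Relation.Nullary using (yes; no)
open import Relation.Binary.PropositionalEquality using (_≡_)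

-- First-order languages (signatures).  Constants are 0-ary function
-- symbols.  Variables are named by natural numbers.

record Language : Set₁ where
  field
    Func   : Set
    Rel    : Set
    farity : Func → ℕ
    rarity : Rel → ℕ
open Language public

module _ (L : Language) where

  data Term : Set where
    var : ℕ → Term
    app : (g : Func L) → Vec Term (farity L g) → Term

  data Fml : Set where
    rel  : (R : Rel L) → Vec Term (rarity L R) → Fml
    _≐_  : Term → Term → Fml
    _∧_  : Fml → Fml → Fml
    ¬_   : Fml → Fml
    all  : ℕ → Fml → Fml

  data Fmlₛ : Set where
    rel  : (R : Rel L) → Vec Term (rarity L R) → Fmlₛ
    _≐_  : Term → Term → Fmlₛ
    _∧_  : Fmlₛ → Fmlₛ → Fmlₛ
    ¬_   : Fmlₛ → Fmlₛ
    all  : ℕ → Fmlₛ → Fmlₛ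
    _∣_  : Fmlₛ → Fmlₛ → Fmlₛ

  data OccursIn (x : ℕ) : Term → Set
  data OccursInVec (x : ℕ) : {k : ℕ} → Vec Term k → Set
  data OccursIn x where
    here : OccursIn x (var x)
    arg  : ∀ {g ts} → OccursInVec x ts → OccursIn x (app g ts)
  data OccursInVec x where
    head : ∀ {k t} {ts : Vec Term k} → OccursIn x t → OccursInVec x (t ∷ ts)
    tail : ∀ {k t} {ts : Vec Term k} → OccursInVec x ts → OccursInVec x (t ∷ ts)

  Closed : Term → Set
  Closed t = ∀ x → OccursIn x t → ⊥

  AllClosed : {n : ℕ} → Vec Term n → Set
  AllClosed ts = ∀ i → Closed (lookup ts i)

  data FreeIn (x : ℕ) : Fml → Set where
    rel  : ∀ {R ts} → OccursInVec x ts → FreeIn x (rel R ts)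
    eqˡ  : ∀ {t u} → OccursIn x t → FreeIn x (t ≐ u)
    eqʳ  : ∀ {t u} → OccursIn x u → FreeIn x (t ≐ u)
    andˡ : ∀ {φ ψ} → FreeIn x φ → FreeIn x (φ ∧ ψ)
    andʳ : ∀ {φ ψ} → FreeIn x ψ → FreeIn x (φ ∧ ψ)
    neg  : ∀ {φ} → FreeIn x φ → FreeIn x (¬ φ)
    all  : ∀ {v φ} → (x ≡ v → ⊥) → FreeIn x φ → FreeIn x (all v φ)

  data FreeInₛ (x : ℕ) : Fmlₛ → Set where
    rel  : ∀ {R ts} → OccursInVec x ts → FreeInₛ x (rel R ts)
    eqˡ  : ∀ {t u} → OccursIn x t → FreeInₛ x (t ≐ u)
    eqʳ  : ∀ {t u} → OccursIn x u → FreeInₛ x (t ≐ u)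
    andˡ : ∀ {φ ψ} → FreeInₛ x φ → FreeInₛ x (φ ∧ ψ)
    andʳ : ∀ {φ ψ} → FreeInₛ x ψ → FreeInₛ x (φ ∧ ψ)
    neg  : ∀ {φ} → FreeInₛ x φ → FreeInₛ x (¬ φ)
    all  : ∀ {v φ} → (x ≡ v → ⊥) → FreeInₛ x φ → FreeInₛ x (all v φ)
    barˡ : ∀ {φ ψ} → FreeInₛ x φ → FreeInₛ x (φ ∣ ψ)
    barʳ : ∀ {φ ψ} → FreeInₛ x ψ → FreeInₛ x (φ ∣ ψ)

  -- "φ(v⃗)": all free variables of φ are among v⃗
  FVsIn : {n : ℕ} → Fml → Vec ℕ n → Set
  FVsIn φ vs = ∀ x → FreeIn x φ → x ∈ vs

  FVsInₛ : {n : ℕ} → Fmlₛ → Vec ℕ n → Set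
  FVsInₛ φ vs = ∀ x → FreeInₛ x φ → x ∈ vs

  Distinct : {n : ℕ} → Vec ℕ n → Set
  Distinct {n} vs = (i j : Fin n) → lookup vs i ≡ lookup vs j → i ≡ j

  substT : (ℕ → Term) → Term → Term
  substTs : {k : ℕ} → (ℕ → Term) → Vec Term k → Vec Term k
  substT σ (var x) = σ x
  substT σ (app g ts) = app g (substTs σ ts)
  substTs σ [] = []
  substTs σ (t ∷ ts) = substT σ t ∷ substTs σ ts

  unbind : ℕ → (ℕ → Term) → ℕ → Term
  unbind v σ x with x ≟ v
  ... | yes _ = var x
  ... | no  _ = σ x

  substF : (ℕ → Term) → Fml → Fml
  substF σ (rel R ts) = rel R (substTs σ ts)
  substF σ (t ≐ u) = substT σ t ≐ substT σ u
  substF σ (φ ∧ ψ) = substF σ φ ∧ substF σ ψ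
  substF σ (¬ φ) = ¬ substF σ φ
  substF σ (all v φ) = all v (substF (unbind v σ) φ)

  substFₛ : (ℕ → Term) → Fmlₛ → Fmlₛ
  substFₛ σ (rel R ts) = rel R (substTs σ ts)
  substFₛ σ (t ≐ u) = substT σ t ≐ substT σ u
  substFₛ σ (φ ∧ ψ) = substFₛ σ φ ∧ substFₛ σ ψ
  substFₛ σ (¬ φ) = ¬ substFₛ σ φ
  substFₛ σ (all v φ) = all v (substFₛ (unbind v σ) φ)
  substFₛ σ (φ ∣ ψ) = substFₛ σ φ ∣ substFₛ σ ψ

  -- the substitution v⃗ ↦ t⃗ (first matching position; v⃗ will be distinct)
  tupleSub : {n : ℕ} → Vec ℕ n → Vec Term n → ℕ → Term
  tupleSub [] [] x = var x
  tupleSub (v ∷ vs) (t ∷ ts) x with x ≟ v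
  ... | yes _ = t
  ... | no  _ = tupleSub vs ts x

  _[_≔_] : {n : ℕ} → Fml → Vec ℕ n → Vec Term n → Fml
  φ [ vs ≔ ts ] = substF (tupleSub vs ts) φ

  _[_≔_]ₛ : {n : ℕ} → Fmlₛ → Vec ℕ n → Vec Term n → Fmlₛ
  φ [ vs ≔ ts ]ₛ = substFₛ (tupleSub vs ts) φ

  allₛ* : {n : ℕ} → Vec ℕ n → Fmlₛ → Fmlₛ
  allₛ* [] φ = φ
  allₛ* (v ∷ vs) φ = all v (allₛ* vs φ)

  -- Structures and satisfaction (domains are nonempty)

  record Structure : Set₁ where
    field
      Carrier : Set
      point   : Carrier
      funI    : (g : Func L) → Vec Carrier (farity L g) → Carrier
      relI    : (R : Rel L) → Vec Carrier (rarity L R) → Set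
  open Structure public

  module _ (M : Structure) where
    eval  : (ℕ → Carrier M) → Term → Carrier M
    evals : {k : ℕ} → (ℕ → Carrier M) → Vec Term k → Vec (Carrier M) k
    eval ρ (var x) = ρ x
    eval ρ (app g ts) = funI M g (evals ρ ts)
    evals ρ [] = []
    evals ρ (t ∷ ts) = eval ρ t ∷ evals ρ ts

    update : (ℕ → Carrier M) → ℕ → Carrier M → ℕ → Carrier M
    update ρ v a x with x ≟ v
    ... | yes _ = a
    ... | no  _ = ρ x

    Sat : (ℕ → Carrier M) → Fml → Set
    Sat ρ (rel R ts) = relI M R (evals ρ ts)
    Sat ρ (t ≐ u) = eval ρ t ≡ eval ρ u
    Sat ρ (φ ∧ ψ) = Sat ρ φ × Sat ρ ψ
    Sat ρ (¬ φ) = Sat ρ φ → ⊥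
    Sat ρ (all v φ) = (a : Carrier M) → Sat (update ρ v a) φ

    -- M ⊨ φ (for sentences: independent of the assignment)
    _⊨_ : Fml → Set
    _⊨_ φ = (ρ : ℕ → Carrier M) → Sat ρ φ

  Satisfiable : Fml → Set₁
  Satisfiable φ = Σ Structure λ M → M ⊨ φ

  record ChoiceFn : Set where
    field
      choose     : Fml → Fml → Fml
      choose-sym : ∀ α β → choose α β ≡ choose β α
      choose-mem : ∀ α β → (choose α β ≡ α) ⊎ (choose α β ≡ β)
  open ChoiceFn public

  collapse : ChoiceFn → Fmlₛ → Fml
  collapse f (rel R ts) = rel R ts
  collapse f (t ≐ u) = t ≐ u
  collapse f (φ ∧ ψ) = collapse f φ ∧ collapse f ψ
  collapse f (¬ φ) = ¬ collapse f φ
  collapse f (all v φ) = all v (collapse f φ)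
  collapse f (φ ∣ ψ) = choose f (collapse f φ) (collapse f ψ)

  _,_⊨¹ₛ_ : Structure → ChoiceFn → Fmlₛ → Set
  M , f ⊨¹ₛ φ = M ⊨ collapse f φ

-- Take ψ := ¬ ((α ∣ β) ∧ ¬ c) with c := f(α,β). It collapses to ¬ (c ∧ ¬ c), so ∀v⃗ ψ holds in
-- every structure, while ψ(r⃗) collapses to ¬ (f(α(r⃗),β(r⃗)) ∧ ¬ c(r⃗)). By (a) and (b) the pairs
-- {α(t⃗),β(t⃗)} and {α(s⃗),β(s⃗)} coincide, so f picks the same formula d from both. Choosing
-- r⃗ ∈ {t⃗, s⃗} so that c(r⃗) is the member of that pair other than d, one of the two structures of
-- (c) satisfies d ∧ ¬ c(r⃗) and hence refutes ψ(r⃗).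
module Submission where

open import Defs
open import Level using (Level)
open import Data.Nat using (ℕ)
open import Data.Vec using (Vec; []; _∷_)
open import Data.Product using (Σ; _×_; _,_; swap)
open import Data.Sum using (inj₁; inj₂)
open import Relation.Binary.PropositionalEquality
  using (_≡_; refl; sym; trans; cong; cong₂; subst; subst₂)

module _ {L : Language} where

  embed : Fml L → Fmlₛ L
  embed (rel R ts) = rel R ts
  embed (t ≐ u) = t ≐ u
  embed (φ ∧ ψ) = embed φ ∧ embed ψ
  embed (¬ φ) = ¬ embed φ
  embed (all v φ) = all v (embed φ)

  collapse-embed : (f : ChoiceFn L) (φ : Fml L) → collapse L f (embed φ) ≡ φ
  collapse-embed f (rel R ts) = refl
  collapse-embed f (t ≐ u) = refl
  collapse-embed f (φ ∧ ψ) = cong₂ _∧_ (collapse-embed f φ) (collapse-embed f ψ)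
  collapse-embed f (¬ φ) = cong ¬_ (collapse-embed f φ)
  collapse-embed f (all v φ) = cong (all v) (collapse-embed f φ)

  collapse-substFₛ-embed : (f : ChoiceFn L) (σ : ℕ → Term L) (φ : Fml L) →
    collapse L f (substFₛ L σ (embed φ)) ≡ substF L σ φ
  collapse-substFₛ-embed f σ (rel R ts) = refl
  collapse-substFₛ-embed f σ (t ≐ u) = refl
  collapse-substFₛ-embed f σ (φ ∧ ψ) =
    cong₂ _∧_ (collapse-substFₛ-embed f σ φ) (collapse-substFₛ-embed f σ ψ)
  collapse-substFₛ-embed f σ (¬ φ) = cong ¬_ (collapse-substFₛ-embed f σ φ)
  collapse-substFₛ-embed f σ (all v φ) = cong (all v) (collapse-substFₛ-embed f (unbind L v σ) φ)

  FreeInₛ-embed⁻ : ∀ {x} (φ : Fml L) → FreeInₛ L x (embed φ) → FreeIn L x φ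
  FreeInₛ-embed⁻ (rel R ts) (rel p) = rel p
  FreeInₛ-embed⁻ (t ≐ u) (eqˡ p) = eqˡ p
  FreeInₛ-embed⁻ (t ≐ u) (eqʳ p) = eqʳ p
  FreeInₛ-embed⁻ (φ ∧ ψ) (andˡ p) = andˡ (FreeInₛ-embed⁻ φ p)
  FreeInₛ-embed⁻ (φ ∧ ψ) (andʳ p) = andʳ (FreeInₛ-embed⁻ ψ p)
  FreeInₛ-embed⁻ (¬ φ) (neg p) = neg (FreeInₛ-embed⁻ φ p)
  FreeInₛ-embed⁻ (all v φ) (all x≢v p) = all x≢v (FreeInₛ-embed⁻ φ p)

  ⊨¹ₛ-allₛ* : (M : Structure L) (f : ChoiceFn L) {n : ℕ} (vs : Vec ℕ n) (ψ : Fmlₛ L) →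
    _,_⊨¹ₛ_ L M f ψ → _,_⊨¹ₛ_ L M f (allₛ* L vs ψ)
  ⊨¹ₛ-allₛ* M f [] ψ M⊨ψ = M⊨ψ
  ⊨¹ₛ-allₛ* M f (v ∷ vs) ψ M⊨ψ ρ a = ⊨¹ₛ-allₛ* M f vs ψ M⊨ψ (update L M ρ v a)

  choose-preserves : {ℓ : Level} (f : ChoiceFn L) (P : Fml L → Set ℓ) {α β : Fml L} →
    P α → P β → P (choose f α β)
  choose-preserves f P {α} {β} Pα Pβ with choose-mem f α β
  ... | inj₁ c≡α = subst P (sym c≡α) Pα
  ... | inj₂ c≡β = subst P (sym c≡β) Pβ

  ⊨-∧¬-cong : (M : Structure L) {φ ψ φ′ ψ′ : Fml L} → φ ≡ φ′ → ψ ≡ ψ′ →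
    _⊨_ L M (φ ∧ (¬ ψ)) → _⊨_ L M (φ′ ∧ (¬ ψ′))
  ⊨-∧¬-cong M = subst₂ (λ φ ψ → _⊨_ L M (φ ∧ (¬ ψ)))

  ⊨-∧¬-swap : (M : Structure L) (φ ψ : Fml L) → _⊨_ L M ((¬ φ) ∧ ψ) → _⊨_ L M (ψ ∧ (¬ φ))
  ⊨-∧¬-swap M φ ψ M⊨ ρ = swap (M⊨ ρ)

module _ {L : Language} {n : ℕ} (vs : Vec ℕ n) (f : ChoiceFn L) (α β : Fml L) where

  private
    infix 30 _⟨_⟩
    _⟨_⟩ : Fml L → Vec (Term L) n → Fml L
    φ ⟨ r ⟩ = _[_≔_] L φ vs r

  ChoiceMismatch : Structure L → Vec (Term L) n → Set
  ChoiceMismatch M r = _⊨_ L M (choose f (α ⟨ r ⟩) (β ⟨ r ⟩) ∧ (¬ (choose f α β ⟨ r ⟩)))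

  choiceAxiom : Fmlₛ L
  choiceAxiom = ¬ ((embed α ∣ embed β) ∧ (¬ embed (choose f α β)))

  collapse-choiceAxiom : collapse L f choiceAxiom ≡ ¬ (choose f α β ∧ (¬ choose f α β))
  collapse-choiceAxiom =
    cong₂ (λ d c → ¬ (d ∧ (¬ c)))
      (cong₂ (choose f) (collapse-embed f α) (collapse-embed f β))
      (collapse-embed f (choose f α β))

  collapse-choiceAxiom-instance : (r : Vec (Term L) n) →
    collapse L f (_[_≔_]ₛ L choiceAxiom vs r)
      ≡ ¬ (choose f (α ⟨ r ⟩) (β ⟨ r ⟩) ∧ (¬ (choose f α β ⟨ r ⟩)))
  collapse-choiceAxiom-instance r =
    cong₂ (λ d c → ¬ (d ∧ (¬ c)))
      (cong₂ (choose f) (collapse-substFₛ-embed f σ α) (collapse-substFₛ-embed f σ β))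
      (collapse-substFₛ-embed f σ (choose f α β))
    where σ = tupleSub L vs r

  choiceAxiom-FVsIn : FVsIn L α vs → FVsIn L β vs → FVsInₛ L choiceAxiom vs
  choiceAxiom-FVsIn fvα fvβ x (neg (andˡ (barˡ p))) = fvα x (FreeInₛ-embed⁻ α p)
  choiceAxiom-FVsIn fvα fvβ x (neg (andˡ (barʳ p))) = fvβ x (FreeInₛ-embed⁻ β p)
  choiceAxiom-FVsIn fvα fvβ x (neg (andʳ (neg p))) =
    choose-preserves f (λ φ → FVsIn L φ vs) fvα fvβ x (FreeInₛ-embed⁻ (choose f α β) p)

  choiceAxiom-counterexample : FVsIn L α vs → FVsIn L β vs →
    (r : Vec (Term L) n) → AllClosed L r → (M : Structure L) → ChoiceMismatch M r →
    Σ (Structure L) λ M → Σ (Fmlₛ L) λ ψ → FVsInₛ L ψ vs ×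
      Σ (Vec (Term L) n) λ r → AllClosed L r ×
        _,_⊨¹ₛ_ L M f (_∧_ (allₛ* L vs ψ) (¬_ (_[_≔_]ₛ L ψ vs r)))
  choiceAxiom-counterexample fvα fvβ r closed M mismatch =
    M , choiceAxiom , choiceAxiom-FVsIn fvα fvβ , r , closed , λ ρ → valid ρ , refuted ρ
    where
    valid : _,_⊨¹ₛ_ L M f (allₛ* L vs choiceAxiom)
    valid = ⊨¹ₛ-allₛ* M f vs choiceAxiom
      (subst (_⊨_ L M) (sym collapse-choiceAxiom) λ ρ (c , ¬c) → ¬c c)
    refuted : _⊨_ L M (¬ collapse L f (_[_≔_]ₛ L choiceAxiom vs r))
    refuted ρ ψr = subst (Sat L M ρ) (collapse-choiceAxiom-instance r) ψr (mismatch ρ)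

  choose-swapped-instances : (t s : Vec (Term L) n) → α ⟨ s ⟩ ≡ β ⟨ t ⟩ → α ⟨ t ⟩ ≡ β ⟨ s ⟩ →
    choose f (α ⟨ s ⟩) (β ⟨ s ⟩) ≡ choose f (α ⟨ t ⟩) (β ⟨ t ⟩)
  choose-swapped-instances t s αs≡βt αt≡βs =
    trans (cong₂ (choose f) αs≡βt (sym αt≡βs)) (choose-sym f _ _)

  choiceMismatch-exists : (t s : Vec (Term L) n) → AllClosed L t → AllClosed L s →
    α ⟨ s ⟩ ≡ β ⟨ t ⟩ → α ⟨ t ⟩ ≡ β ⟨ s ⟩ →
    Satisfiable L (α ⟨ t ⟩ ∧ (¬ β ⟨ t ⟩)) → Satisfiable L ((¬ α ⟨ t ⟩) ∧ β ⟨ t ⟩) →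
    Σ (Vec (Term L) n) λ r → AllClosed L r × Σ (Structure L) λ M → ChoiceMismatch M r
  choiceMismatch-exists t s closedt closeds αs≡βt αt≡βs (M₁ , M₁⊨) (M₂ , M₂⊨)
    with choose-mem f α β | choose-mem f (α ⟨ t ⟩) (β ⟨ t ⟩)
  ... | inj₁ c≡α | inj₁ d≡αt =
    s , closeds , M₁ , ⊨-∧¬-cong M₁ (sym (trans (choose-swapped-instances t s αs≡βt αt≡βs) d≡αt))
                                    (trans (sym αs≡βt) (cong _⟨ s ⟩ (sym c≡α))) M₁⊨
  ... | inj₁ c≡α | inj₂ d≡βt =
    t , closedt , M₂ , ⊨-∧¬-cong M₂ (sym d≡βt) (cong _⟨ t ⟩ (sym c≡α)) (⊨-∧¬-swap M₂ (α ⟨ t ⟩) (β ⟨ t ⟩) M₂⊨)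
  ... | inj₂ c≡β | inj₁ d≡αt =
    t , closedt , M₁ , ⊨-∧¬-cong M₁ (sym d≡αt) (cong _⟨ t ⟩ (sym c≡β)) M₁⊨
  ... | inj₂ c≡β | inj₂ d≡βt =
    s , closeds , M₂ , ⊨-∧¬-cong M₂ (sym (trans (choose-swapped-instances t s αs≡βt αt≡βs) d≡βt))
                                    (trans αt≡βs (cong _⟨ s ⟩ (sym c≡β))) (⊨-∧¬-swap M₂ (α ⟨ t ⟩) (β ⟨ t ⟩) M₂⊨)

theorem3p5 : (L : Language) (n : ℕ) (vs : Vec ℕ n) → Distinct L vs →
    (α β : Fml L) → FVsIn L α vs → FVsIn L β vs →
    (t s : Vec (Term L) n) → AllClosed L t → AllClosed L s →
    _[_≔_] L α vs s ≡ _[_≔_] L β vs t →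
    _[_≔_] L α vs t ≡ _[_≔_] L β vs s →
    Satisfiable L (_∧_ (_[_≔_] L α vs t) (¬_ (_[_≔_] L β vs t))) →
    Satisfiable L (_∧_ (¬_ (_[_≔_] L α vs t)) (_[_≔_] L β vs t)) →
    (f : ChoiceFn L) →
    Σ (Structure L) λ M → Σ (Fmlₛ L) λ ψ → FVsInₛ L ψ vs ×
      Σ (Vec (Term L) n) λ r → AllClosed L r ×
        _,_⊨¹ₛ_ L M f (_∧_ (allₛ* L vs ψ) (¬_ (_[_≔_]ₛ L ψ vs r)))
theorem3p5 L n vs _ α β fvα fvβ t s closedt closeds αs≡βt αt≡βs sat₁ sat₂ f
  with choiceMismatch-exists vs f α β t s closedt closeds αs≡βt αt≡βs sat₁ sat₂
... | r , closedr , M , mismatch =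
  choiceAxiom-counterexample vs f α β fvα fvβ r closedr M mismatch
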